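{- Let $(G,m)$ be a finite weighted digraph with $G=(V,A,\partial)$ and let $V'\subset V$ be a maximal chain. Then: (i) the subdigraph $G'$ induced by $V'$ has a unique sink $S_{V'}$ and a unique source $F_{V'}$; (ii) every vertex of $S_{V'}$ is an upper bound of $V'$, and every vertex of $F_{V'}$ is a lower bound of $V'$.
   Context: A finite digraph $G=(V,A,\partial)$: finite disjoint sets $V$, $A$, incidence $\partial a=(\partial_-a,\partial_+a)$ (initial, terminal vertex); multiple arcs and loops allowed; weights $m>0$. The subdigraph induced by $V'\subset V$ has vertex set $V'$ and all arcs $a$ of $G$ with $\partial_-a,\partial_+a\in V'$. A directed path is a sequence $v_0,a_1,v_1,\dots,a_p,v_p$ ($p\ge0$) with $\partial_-a_j=v_{j-1}$, $\partial_+a_j=v_j$ and distinct vertices; write $v_0\rightsquigarrow v_p$. A chain is $V'\subset V$ with $u\rightsquigarrow v$ or $v\rightsquigarrow u$ for all $u,v\in V'$; a maximal chain is one not properly contained in another chain. A lower (upper) bound of a chain $V'$ is a vertex $v\in V'$ with $v\rightsquigarrow u$ (resp. $u\rightsquigarrow v$) for all $u\in V'$. A strongly connected component (SCC) of a digraph is a maximal induced subdigraph in which every two vertices $u,v$ satisfy both $u\rightsquigarrow v$ and $v\rightsquigarrow u$. A source of a digraph is the vertex set $F$ of an SCC such that no arc has initial vertex outside $F$ and terminal vertex in $F$; a sink is the vertex set $S$ of an SCC such that no arc has initial vertex in $S$ and terminal vertex outside $S$. Sources and sinks of $G'$ are taken with respect to the digraph $G'$.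
   Formalization: The arc weights m are positive rationals. -}

module Defs where

open import Data.Nat using (ℕ)
open import Data.Fin using (Fin)
open import Data.Fin.Subset using (Subset; _∈_; _∉_; _⊆_)
open import Data.List using (List; []; _∷_)
open import Data.List.Relation.Unary.Unique.Propositional using (Unique)
open import Data.List.Relation.Unary.All using (All)
open import Data.Product using (Σ; _×_; ∃)
open import Data.Sum using (_⊎_)
open import Data.Rational using (ℚ; 0ℚ; _<_)
open import Relation.Binary.PropositionalEquality using (_≡_)

-- A finite digraph G = (V, A, ∂) with V = Fin n, A = Fin k,
-- ∂ a = (init a , term a). Multiple arcs and loops are allowed.
record Digraph : Set where
  field
    n    : ℕ
    k    : ℕ
    init : Fin k → Fin n
    term : Fin k → Fin n

record WeightedDigraph : Set where
  field
    G      : Digraph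
    m      : Fin (Digraph.k G) → ℚ
    m-pos  : ∀ a → 0ℚ < m a

module _ (G : Digraph) where
  open Digraph G

  data Walk : Fin n → Fin n → Set where
    nil  : ∀ {v} → Walk v v
    cons : ∀ {w} (a : Fin k) → Walk (term a) w → Walk (init a) w

  vertices : ∀ {u w} → Walk u w → List (Fin n)
  vertices {u} nil = u ∷ []
  vertices {u} (cons a p) = u ∷ vertices p

  IsPath : ∀ {u w} → Walk u w → Set
  IsPath p = Unique (vertices p)

  Reach : Fin n → Fin n → Set
  Reach u w = Σ (Walk u w) IsPath

  -- u ⇝ w in the subdigraph induced by X: a directed path of G all of whose
  -- vertices lie in X (equivalently all of whose arcs are arcs of the
  -- induced subdigraph)
  ReachIn : Subset n → Fin n → Fin n → Set
  ReachIn X u w = Σ (Walk u w) λ p → IsPath p × All (_∈ X) (vertices p)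

  IsChain : Subset n → Set
  IsChain X = ∀ u v → u ∈ X → v ∈ X → Reach u v ⊎ Reach v u

  IsMaximalChain : Subset n → Set
  IsMaximalChain X = IsChain X × (∀ Y → IsChain Y → X ⊆ Y → Y ⊆ X)

  IsUpperBound : Subset n → Fin n → Set
  IsUpperBound X v = v ∈ X × (∀ u → u ∈ X → Reach u v)

  IsLowerBound : Subset n → Fin n → Set
  IsLowerBound X v = v ∈ X × (∀ u → u ∈ X → Reach v u)

  -- Notions relative to the subdigraph G' induced by V'.
  -- C ⊆ V' induces a strongly connected subdigraph (paths inside C)
  IsStronglyConnectedIn : Subset n → Subset n → Set
  IsStronglyConnectedIn V' C = C ⊆ V' × (∀ u v → u ∈ C → v ∈ C → ReachIn C u v × ReachIn C v u)

  IsSCCIn : Subset n → Subset n → Set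
  IsSCCIn V' C = IsStronglyConnectedIn V' C
               × (∀ D → IsStronglyConnectedIn V' D → C ⊆ D → D ⊆ C)

  IsSinkIn : Subset n → Subset n → Set
  IsSinkIn V' S = IsSCCIn V' S
                × (∀ a → init a ∈ V' → term a ∈ V' → init a ∈ S → term a ∈ S)

  IsSourceIn : Subset n → Subset n → Set
  IsSourceIn V' F = IsSCCIn V' F
                  × (∀ a → init a ∈ V' → term a ∈ V' → term a ∈ F → init a ∈ F)

{-# OPTIONS --safe #-}
-- Reachability restricted to a maximal chain V' is a total preorder, and V' contains every
-- vertex comparable with all of its elements.  Hence the upper bounds of V' are closed under
-- reachability, and they form a sink of G'.  Conversely, from a vertex of any sink of G' one can
-- walk inside V' to an upper bound: if a path between two chain elements leaves V', some chain
-- element lies strictly between them, and induction on the number of such elements yields a walk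
-- inside V'.  So every sink meets, and by maximality of strongly connected components equals,
-- the set of upper bounds.  Sources are the sinks of the reversed digraph.
module Submission where

open import Defs
open import Data.Bool using (true)
open import Data.Empty using (⊥-elim)
open import Data.Fin using (Fin; zero; suc; toℕ; fromℕ<; _≟_)
import Data.Fin.Properties as Finₚ
open import Data.Fin.Subset using (Subset; _∈_; _⊆_; _⊂_; _∪_; ⁅_⁆)
open import Data.Fin.Subset.Induction using (⊂-wellFounded)
import Data.Fin.Subset.Properties as Subsetₚ
open import Data.List using (List; []; _∷_; length; lookup; allFin)
open import Data.List.Membership.Propositional using () renaming (_∈_ to _∈ˡ_)
open import Data.List.Membership.Propositional.Properties using (∈-lookup; ∈-allFin)
open import Data.List.Relation.Binary.Subset.Propositional using () renaming (_⊆_ to _⊆ˡ_)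
open import Data.List.Relation.Unary.All as All using (All; []; _∷_)
open import Data.List.Relation.Unary.All.Properties using (¬Any⇒All¬)
open import Data.List.Relation.Unary.Any using (here; there)
open import Data.List.Relation.Unary.AllPairs using ([]; _∷_)
open import Data.List.Relation.Unary.Unique.Propositional using (Unique)
open import Data.Nat using (ℕ; suc; _≤_; _<_)
import Data.Nat.Properties as ℕₚ
open import Data.Product as Product using (Σ; ∃; _×_; _,_; proj₁; proj₂)
open import Data.Sum as Sum using (_⊎_; inj₁; inj₂)
open import Data.Unit using (⊤)
open import Data.Vec using (tabulate)
open import Data.Vec.Properties using (lookup∘tabulate; []=⇒lookup; lookup⇒[]=)
open import Induction.WellFounded using (Acc; acc)
open import Relation.Nullary using (¬_; Dec; yes; no; does; ¬?)
open import Relation.Nullary.Decidable using (map′; dec-true; _×-dec_; _→-dec_)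
open import Relation.Unary using (Decidable)
open import Relation.Binary.PropositionalEquality using (_≡_; refl; sym; trans; cong; subst)

lookup-injective : ∀ {A : Set} {xs : List A} → Unique xs →
                   ∀ {i j} → lookup xs i ≡ lookup xs j → i ≡ j
lookup-injective {xs = _ ∷ _} (_ ∷ _) {zero} {zero} _ = refl
lookup-injective {xs = _ ∷ _} (x∉xs ∷ _) {zero} {suc j} eq =
  ⊥-elim (All.lookup x∉xs (∈-lookup j) eq)
lookup-injective {xs = _ ∷ _} (x∉xs ∷ _) {suc i} {zero} eq =
  ⊥-elim (All.lookup x∉xs (∈-lookup i) (sym eq))
lookup-injective {xs = _ ∷ _} (_ ∷ xs!) {suc i} {suc j} eq =
  cong suc (lookup-injective xs! eq)

Unique⇒length≤ : ∀ {n} {xs : List (Fin n)} → Unique xs → length xs ≤ n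
Unique⇒length≤ xs! = Finₚ.injective⇒≤ (lookup-injective xs!)

module _ {n} {P : Fin n → Set} (P? : Decidable P) where

  toSubset : Subset n
  toSubset = tabulate (λ x → does (P? x))

  ∈-toSubset⁺ : ∀ {x} → P x → x ∈ toSubset
  ∈-toSubset⁺ {x} px = lookup⇒[]= x toSubset (trans (lookup∘tabulate _ x) (dec-true (P? x) px))

  ∈-toSubset⁻ : ∀ {x} → x ∈ toSubset → P x
  ∈-toSubset⁻ {x} x∈ = witness (P? x) (trans (sym (lookup∘tabulate _ x)) ([]=⇒lookup x∈))
    where
    witness : ∀ {A : Set} (a? : Dec A) → does a? ≡ true → A
    witness (yes a) _ = a

module _ {A : Set} {P : A → Set} {_≲_ : A → A → Set} (P? : Decidable P)
         (≲-refl : ∀ {x} → x ≲ x) (≲-trans : ∀ {x y z} → x ≲ y → y ≲ z → x ≲ z)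
         (≲-total : ∀ {x y} → P x → P y → x ≲ y ⊎ y ≲ x) where

  maximum : ∀ xs {m} → P m → Σ A λ m′ → P m′ × m ≲ m′ × (∀ {x} → x ∈ˡ xs → P x → x ≲ m′)
  maximum [] pm = _ , pm , ≲-refl , λ ()
  maximum (x ∷ xs) {m} pm with P? x
  ... | no ¬px =
    let m′ , pm′ , m≲m′ , max = maximum xs pm in
    m′ , pm′ , m≲m′ , λ { (here refl) px → ⊥-elim (¬px px) ; (there x∈) → max x∈ }
  ... | yes px with ≲-total px pm
  ...   | inj₁ x≲m =
    let m′ , pm′ , m≲m′ , max = maximum xs pm in
    m′ , pm′ , m≲m′ , λ { (here refl) _ → ≲-trans x≲m m≲m′ ; (there x∈) → max x∈ }
  ...   | inj₂ m≲x =
    let m′ , pm′ , x≲m′ , max = maximum xs px in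
    m′ , pm′ , ≲-trans m≲x x≲m′ , λ { (here refl) _ → x≲m′ ; (there x∈) → max x∈ }

module Reachability (G : Digraph) where
  open Digraph G
  open import Data.List.Membership.DecPropositional (_≟_ {n}) using (_∈?_)

  _++ʷ_ : ∀ {u v w} → Walk G u v → Walk G v w → Walk G u w
  nil      ++ʷ q = q
  cons a p ++ʷ q = cons a (p ++ʷ q)

  All-++ʷ : ∀ {P : Fin n → Set} {u v w} (p : Walk G u v) {q : Walk G v w} →
            All P (vertices G p) → All P (vertices G q) → All P (vertices G (p ++ʷ q))
  All-++ʷ nil        _         Pq = Pq
  All-++ʷ (cons a p) (Pu ∷ Pp) Pq = Pu ∷ All-++ʷ p Pp Pq

  All-source : ∀ {P : Fin n → Set} {u w} (p : Walk G u w) → All P (vertices G p) → P u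
  All-source nil        (Pu ∷ _) = Pu
  All-source (cons _ _) (Pu ∷ _) = Pu

  walk-suffix : ∀ {u v w} (p : Walk G u w) → v ∈ˡ vertices G p →
                Σ (Walk G v w) λ q → (IsPath G p → IsPath G q) × vertices G q ⊆ˡ vertices G p
  walk-suffix nil        (here refl) = nil , (λ p-path → p-path) , (λ x∈ → x∈)
  walk-suffix (cons a p) (here refl) = cons a p , (λ p-path → p-path) , (λ x∈ → x∈)
  walk-suffix (cons a p) (there v∈p) =
    let q , q-path , q⊆p = walk-suffix p v∈p in
    q , (λ { (_ ∷ p-path) → q-path p-path }) , (λ x∈ → there (q⊆p x∈))

  -- Loop erasure: if the first vertex recurs on the shortened tail, cut back to its occurrence.
  erase-loops : ∀ {u w} (p : Walk G u w) →
                Σ (Walk G u w) λ q → IsPath G q × vertices G q ⊆ˡ vertices G p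
  erase-loops nil = nil , [] ∷ [] , (λ x∈ → x∈)
  erase-loops (cons a p) with erase-loops p
  ... | q , q-path , q⊆p with init a ∈? vertices G q
  ...   | yes a∈q = let r , r-path , r⊆q = walk-suffix q a∈q in
                    r , r-path q-path , (λ x∈ → there (q⊆p (r⊆q x∈)))
  ...   | no  a∉q = cons a q , ¬Any⇒All¬ _ a∉q ∷ q-path ,
                    λ { (here eq) → here eq ; (there x∈) → there (q⊆p x∈) }

  walk⇒reach : ∀ {u w} → Walk G u w → Reach G u w
  walk⇒reach p = let q , q-path , _ = erase-loops p in q , q-path

  WalkWithin : Subset n → Fin n → Fin n → Set
  WalkWithin X u w = Σ (Walk G u w) λ p → All (_∈ X) (vertices G p)

  walkWithin⇒reachIn : ∀ {X u w} → WalkWithin X u w → ReachIn G X u w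
  walkWithin⇒reachIn (p , p⊆X) =
    let q , q-path , q⊆p = erase-loops p in
    q , q-path , All.tabulate (λ x∈ → All.lookup p⊆X (q⊆p x∈))

  reach-refl : ∀ {u} → Reach G u u
  reach-refl = nil , [] ∷ []

  reach-trans : ∀ {u v w} → Reach G u v → Reach G v w → Reach G u w
  reach-trans (p , _) (q , _) = walk⇒reach (p ++ʷ q)

  arc⇒reach : ∀ a → Reach G (init a) (term a)
  arc⇒reach a = walk⇒reach (cons a nil)

  reach-along : ∀ {u w} (p : Walk G u w) → All (λ x → Reach G u x × Reach G x w) (vertices G p)
  reach-along nil        = (reach-refl , reach-refl) ∷ []
  reach-along (cons a p) =
    (reach-refl , walk⇒reach (cons a p)) ∷
    All.map (Product.map₁ (reach-trans (arc⇒reach a))) (reach-along p)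

  walkLength : ∀ {u w} → Walk G u w → ℕ
  walkLength nil        = 0
  walkLength (cons _ p) = suc (walkLength p)

  length-vertices : ∀ {u w} (p : Walk G u w) → length (vertices G p) ≡ suc (walkLength p)
  length-vertices nil        = refl
  length-vertices (cons _ p) = cong suc (length-vertices p)

  path-walkLength< : ∀ {u w} (p : Walk G u w) → IsPath G p → walkLength p < n
  path-walkLength< p p-path = subst (_≤ n) (length-vertices p) (Unique⇒length≤ p-path)

  walkOfLength? : ∀ ℓ u w → Dec (Σ (Walk G u w) λ p → walkLength p ≡ ℓ)
  walkOfLength? 0 u w with u ≟ w
  ... | yes refl = yes (nil , refl)
  ... | no  u≢w  = no λ { (nil , _) → u≢w refl ; (cons _ _ , ()) }
  walkOfLength? (suc ℓ) u w =
    map′ extend restrict (Finₚ.any? λ a → (init a ≟ u) ×-dec walkOfLength? ℓ (term a) w)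
    where
    extend : ∃ (λ a → init a ≡ u × Σ (Walk G (term a) w) λ p → walkLength p ≡ ℓ) →
             Σ (Walk G u w) λ p → walkLength p ≡ suc ℓ
    extend (a , refl , p , refl) = cons a p , refl
    restrict : (Σ (Walk G u w) λ p → walkLength p ≡ suc ℓ) →
               ∃ (λ a → init a ≡ u × Σ (Walk G (term a) w) λ p → walkLength p ≡ ℓ)
    restrict (cons a p , eq) = a , refl , p , ℕₚ.suc-injective eq

  reach? : ∀ u w → Dec (Reach G u w)
  reach? u w = map′ shorten lengthOf (Finₚ.any? λ ℓ → walkOfLength? (toℕ ℓ) u w)
    where
    shorten : ∃ (λ ℓ → Σ (Walk G u w) λ p → walkLength p ≡ toℕ ℓ) → Reach G u w
    shorten (_ , p , _) = walk⇒reach p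
    lengthOf : Reach G u w → ∃ (λ ℓ → Σ (Walk G u w) λ p → walkLength p ≡ toℕ ℓ)
    lengthOf (p , p-path) = fromℕ< (path-walkLength< p p-path) , p , sym (Finₚ.toℕ-fromℕ< _)

  sink-closed : ∀ {V' S x w} → IsSinkIn G V' S → WalkWithin V' x w → x ∈ S → w ∈ S
  sink-closed S-sink (nil , _) x∈S = x∈S
  sink-closed S-sink (cons a p , init∈V' ∷ p⊆V') init∈S =
    sink-closed S-sink (p , p⊆V') (proj₂ S-sink a init∈V' (All-source p p⊆V') init∈S)

module MaximalChain (G : Digraph) {V' : Subset (Digraph.n G)} (V'-maximal : IsMaximalChain G V')
  where
  open Digraph G
  open Reachability G

  private
    V'-chain : IsChain G V'
    V'-chain = proj₁ V'-maximal

  comparable⇒∈ : ∀ x → (∀ y → y ∈ V' → Reach G y x ⊎ Reach G x y) → x ∈ V'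
  comparable⇒∈ x comparable = proj₂ V'-maximal (V' ∪ ⁅ x ⁆) V'+x-chain
    (λ y∈ → Subsetₚ.x∈p∪q⁺ (inj₁ y∈)) (Subsetₚ.x∈p∪q⁺ (inj₂ (Subsetₚ.x∈⁅x⁆ x)))
    where
    comparable′ : ∀ u v → u ∈ V' ⊎ u ∈ ⁅ x ⁆ → v ∈ V' ⊎ v ∈ ⁅ x ⁆ → Reach G u v ⊎ Reach G v u
    comparable′ u v (inj₁ u∈) (inj₁ v∈) = V'-chain u v u∈ v∈
    comparable′ u v (inj₁ u∈) (inj₂ v∈) with refl ← Subsetₚ.x∈⁅y⁆⇒x≡y x v∈ = comparable u u∈
    comparable′ u v (inj₂ u∈) (inj₁ v∈) with refl ← Subsetₚ.x∈⁅y⁆⇒x≡y x u∈ =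
      Sum.swap (comparable v v∈)
    comparable′ u v (inj₂ u∈) (inj₂ v∈)
      with refl ← Subsetₚ.x∈⁅y⁆⇒x≡y x u∈ | refl ← Subsetₚ.x∈⁅y⁆⇒x≡y x v∈ = inj₁ reach-refl
    V'+x-chain : IsChain G (V' ∪ ⁅ x ⁆)
    V'+x-chain u v u∈ v∈ = comparable′ u v (Subsetₚ.x∈p∪q⁻ V' ⁅ x ⁆ u∈) (Subsetₚ.x∈p∪q⁻ V' ⁅ x ⁆ v∈)

  chain-reach : ∀ {u v} → u ∈ V' → v ∈ V' → ¬ Reach G v u → Reach G u v
  chain-reach {u} {v} u∈ v∈ ¬v⇝u with V'-chain u v u∈ v∈
  ... | inj₁ u⇝v = u⇝v
  ... | inj₂ v⇝u = ⊥-elim (¬v⇝u v⇝u)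

  walk-⊆-chain : ∀ {u w} (p : Walk G u w) → (∀ y → y ∈ V' → Reach G y u ⊎ Reach G w y) →
                 All (_∈ V') (vertices G p)
  walk-⊆-chain p separated = All.map through (reach-along p)
    where
    through : ∀ {x} → Reach G _ x × Reach G x _ → x ∈ V'
    through (u⇝x , x⇝w) = comparable⇒∈ _ λ y y∈ →
      Sum.map (λ y⇝u → reach-trans y⇝u u⇝x) (reach-trans x⇝w) (separated y y∈)

  upperBound-reach : ∀ {t x} → IsUpperBound G V' t → Reach G t x → IsUpperBound G V' x
  upperBound-reach (_ , t-upper) t⇝x =
    comparable⇒∈ _ (λ y y∈ → inj₁ (y⇝x y y∈)) , y⇝x
    where
    y⇝x : ∀ y → y ∈ V' → Reach G y _
    y⇝x y y∈ = reach-trans (t-upper y y∈) t⇝x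

  upperBound? : Decidable (IsUpperBound G V')
  upperBound? v = (v Subsetₚ.∈? V') ×-dec Finₚ.all? (λ u → (u Subsetₚ.∈? V') →-dec reach? u v)

  upperBound-exists : ∀ {u} → u ∈ V' → ∃ (IsUpperBound G V')
  upperBound-exists u∈ =
    let t , t∈ , _ , max = maximum (Subsetₚ._∈? V') reach-refl reach-trans
                                   (V'-chain _ _) (allFin n) u∈ in
    t , t∈ , λ y y∈ → max (∈-allFin y) y∈

  top : Subset n
  top = toSubset upperBound?

  top-stronglyConnected : IsStronglyConnectedIn G V' top
  top-stronglyConnected =
    (λ t∈ → proj₁ (∈-toSubset⁻ upperBound? t∈)) , λ u v u∈ v∈ → within u∈ v∈ , within v∈ u∈
    where
    within : ∀ {u v} → u ∈ top → v ∈ top → ReachIn G top u v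
    within u∈ v∈ =
      let u-upper = ∈-toSubset⁻ upperBound? u∈
          p , p-path = proj₂ (∈-toSubset⁻ upperBound? v∈) _ (proj₁ u-upper) in
      p , p-path , All.map (λ (u⇝x , _) → ∈-toSubset⁺ upperBound? (upperBound-reach u-upper u⇝x))
                           (reach-along p)

  top-scc : IsSCCIn G V' top
  top-scc = top-stronglyConnected , maximal
    where
    maximal : ∀ D → IsStronglyConnectedIn G V' D → top ⊆ D → D ⊆ top
    maximal D (D⊆V' , D-sc) top⊆D d∈ =
      let t , t-upper = upperBound-exists (D⊆V' d∈)
          p , p-path , _ = proj₁ (D-sc _ _ (top⊆D (∈-toSubset⁺ upperBound? t-upper)) d∈) in
      ∈-toSubset⁺ upperBound? (upperBound-reach t-upper (p , p-path))

  top-sink : IsSinkIn G V' top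
  top-sink = top-scc , λ a _ _ init∈ →
    ∈-toSubset⁺ upperBound? (upperBound-reach (∈-toSubset⁻ upperBound? init∈) (arc⇒reach a))

  -- Since V' is a chain, these are its elements strictly between u and v.
  InGap : Fin n → Fin n → Fin n → Set
  InGap u v y = y ∈ V' × ¬ Reach G y u × ¬ Reach G v y

  gap? : ∀ u v → Decidable (InGap u v)
  gap? u v y = (y Subsetₚ.∈? V') ×-dec ¬? (reach? y u) ×-dec ¬? (reach? v y)

  gap : Fin n → Fin n → Subset n
  gap u v = toSubset (gap? u v)

  gap-shrinksˡ : ∀ {u v y} → Reach G y v → y ∈ gap u v → gap u y ⊂ gap u v
  gap-shrinksˡ {u} {v} {y} y⇝v y∈ =
    shrink , y , y∈ , λ y∈′ → proj₂ (proj₂ (∈-toSubset⁻ (gap? u y) y∈′)) reach-refl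
    where
    shrink : gap u y ⊆ gap u v
    shrink z∈ =
      let z∈V' , ¬z⇝u , ¬y⇝z = ∈-toSubset⁻ (gap? u y) z∈ in
      ∈-toSubset⁺ (gap? u v) (z∈V' , ¬z⇝u , λ v⇝z → ¬y⇝z (reach-trans y⇝v v⇝z))

  gap-shrinksʳ : ∀ {u v y} → Reach G u y → y ∈ gap u v → gap y v ⊂ gap u v
  gap-shrinksʳ {u} {v} {y} u⇝y y∈ =
    shrink , y , y∈ , λ y∈′ → proj₁ (proj₂ (∈-toSubset⁻ (gap? y v) y∈′)) reach-refl
    where
    shrink : gap y v ⊆ gap u v
    shrink z∈ =
      let z∈V' , ¬z⇝y , ¬v⇝z = ∈-toSubset⁻ (gap? y v) z∈ in
      ∈-toSubset⁺ (gap? u v) (z∈V' , (λ z⇝u → ¬z⇝y (reach-trans z⇝u u⇝y)) , ¬v⇝z)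

  reach⇒walkWithin : ∀ {u v} → Acc _⊂_ (gap u v) → u ∈ V' → v ∈ V' → Reach G u v → WalkWithin V' u v
  reach⇒walkWithin {u} {v} (acc smaller) u∈ v∈ (p , _) with Subsetₚ.nonempty? (gap u v)
  ... | no gap-empty = p , walk-⊆-chain p separated
    where
    separated : ∀ y → y ∈ V' → Reach G y u ⊎ Reach G v y
    separated y y∈ with reach? y u | reach? v y
    ... | yes y⇝u | _        = inj₁ y⇝u
    ... | no  _   | yes v⇝y  = inj₂ v⇝y
    ... | no ¬y⇝u | no ¬v⇝y = ⊥-elim (gap-empty (y , ∈-toSubset⁺ (gap? u v) (y∈ , ¬y⇝u , ¬v⇝y)))
  ... | yes (y , y∈gap) =
    let y∈V' , ¬y⇝u , ¬v⇝y = ∈-toSubset⁻ (gap? u v) y∈gap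
        u⇝y = chain-reach u∈ y∈V' ¬y⇝u
        y⇝v = chain-reach y∈V' v∈ ¬v⇝y
        p₁ , p₁⊆V' = reach⇒walkWithin (smaller (gap-shrinksˡ y⇝v y∈gap)) u∈ y∈V' u⇝y
        p₂ , p₂⊆V' = reach⇒walkWithin (smaller (gap-shrinksʳ u⇝y y∈gap)) y∈V' v∈ y⇝v in
    p₁ ++ʷ p₂ , All-++ʷ p₁ p₁⊆V' p₂⊆V'

  sink-unique : ∀ {S} → IsSinkIn G V' S → S ≡ top
  sink-unique {S} S-sink@(((S⊆V' , S-sc) , S-maximal) , _) =
    Subsetₚ.⊆-antisym S⊆top (S-maximal top top-stronglyConnected S⊆top)
    where
    S⊆top : S ⊆ top
    S⊆top {s} s∈ =
      let s∈V' = S⊆V' s∈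
          t , t-upper = upperBound-exists s∈V'
          s⇝t = proj₂ t-upper s s∈V'
          t∈S = sink-closed S-sink (reach⇒walkWithin (⊂-wellFounded _) s∈V' (proj₁ t-upper) s⇝t) s∈
          q , q-path , _ = proj₂ (S-sc s _ s∈ t∈S) in
      ∈-toSubset⁺ upperBound? (upperBound-reach t-upper (q , q-path))

  uniqueSink : Σ (Subset n) λ S → IsSinkIn G V' S × (∀ S₂ → IsSinkIn G V' S₂ → S₂ ≡ S)
                                 × (∀ v → v ∈ S → IsUpperBound G V' v)
  uniqueSink = top , top-sink , (λ _ → sink-unique) , λ _ → ∈-toSubset⁻ upperBound?

reverse : Digraph → Digraph
reverse G = record { n = n ; k = k ; init = term ; term = init }
  where open Digraph G

module Reversal (G : Digraph) where
  open Digraph G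
  open Reachability G using (All-source)
  private module Rev = Reachability (reverse G)

  reverse-walk : ∀ {P : Fin n → Set} {u w} (p : Walk G u w) → All P (vertices G p) →
                 Σ (Walk (reverse G) w u) λ q → All P (vertices (reverse G) q)
  reverse-walk nil        Pp        = nil , Pp
  reverse-walk (cons a p) (Pu ∷ Pp) =
    let q , Pq = reverse-walk p Pp in
    q Rev.++ʷ cons a nil , Rev.All-++ʷ q Pq (All-source p Pp ∷ Pu ∷ [])

  reverse-reach : ∀ {u w} → Reach G u w → Reach (reverse G) w u
  reverse-reach (p , _) = Rev.walk⇒reach (proj₁ (reverse-walk {P = λ _ → ⊤} p (All.universal _ _)))

  reverse-reachIn : ∀ {X u w} → ReachIn G X u w → ReachIn (reverse G) X w u
  reverse-reachIn (p , _ , p⊆X) = Rev.walkWithin⇒reachIn (reverse-walk p p⊆X)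

  reverse-chain : ∀ {X} → IsChain G X → IsChain (reverse G) X
  reverse-chain X-chain u v u∈ v∈ =
    Sum.swap (Sum.map reverse-reach reverse-reach (X-chain u v u∈ v∈))

  reverse-stronglyConnected : ∀ {V' C} → IsStronglyConnectedIn G V' C →
                              IsStronglyConnectedIn (reverse G) V' C
  reverse-stronglyConnected (C⊆V' , C-sc) =
    C⊆V' , λ u v u∈ v∈ → Product.swap (Product.map reverse-reachIn reverse-reachIn (C-sc u v u∈ v∈))

reverse-maximalChain : ∀ G {X} → IsMaximalChain G X → IsMaximalChain (reverse G) X
reverse-maximalChain G (X-chain , X-maximal) =
  Reversal.reverse-chain G X-chain ,
  λ Y Y-chain → X-maximal Y (Reversal.reverse-chain (reverse G) Y-chain)

reverse-scc : ∀ G {V' C} → IsSCCIn G V' C → IsSCCIn (reverse G) V' C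
reverse-scc G (C-sc , C-maximal) =
  Reversal.reverse-stronglyConnected G C-sc ,
  λ D D-sc → C-maximal D (Reversal.reverse-stronglyConnected (reverse G) D-sc)

source⇒reverse-sink : ∀ G {V' F} → IsSourceIn G V' F → IsSinkIn (reverse G) V' F
source⇒reverse-sink G (F-scc , F-closed) =
  reverse-scc G F-scc , λ a init∈ term∈ → F-closed a term∈ init∈

reverse-sink⇒source : ∀ G {V' S} → IsSinkIn (reverse G) V' S → IsSourceIn G V' S
reverse-sink⇒source G (S-scc , S-closed) =
  reverse-scc (reverse G) S-scc , λ a init∈ term∈ → S-closed a term∈ init∈

uniqueSource : ∀ G {V'} → IsMaximalChain G V' →
               Σ (Subset (Digraph.n G)) λ F → IsSourceIn G V' F
                                            × (∀ F₂ → IsSourceIn G V' F₂ → F₂ ≡ F)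
                                            × (∀ v → v ∈ F → IsLowerBound G V' v)
uniqueSource G V'-maximal =
  let F , F-sink , F-unique , F-upper =
        MaximalChain.uniqueSink (reverse G) (reverse-maximalChain G V'-maximal) in
  F , reverse-sink⇒source G F-sink ,
  (λ F₂ F₂-source → F-unique F₂ (source⇒reverse-sink G F₂-source)) ,
  λ v v∈ → Product.map₂ (λ upper u u∈ → Reversal.reverse-reach (reverse G) (upper u u∈)) (F-upper v v∈)

proposition3p6 : (W : WeightedDigraph) →
    let G = WeightedDigraph.G W in
    (V' : Subset (Digraph.n G)) → IsMaximalChain G V' →
      (Σ (Subset (Digraph.n G)) λ S →
          IsSinkIn G V' S
        × (∀ S₂ → IsSinkIn G V' S₂ → S₂ ≡ S)
        × (∀ v → v ∈ S → IsUpperBound G V' v))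
    × (Σ (Subset (Digraph.n G)) λ F →
          IsSourceIn G V' F
        × (∀ F₂ → IsSourceIn G V' F₂ → F₂ ≡ F)
        × (∀ v → v ∈ F → IsLowerBound G V' v))
proposition3p6 W V' V'-maximal =
  MaximalChain.uniqueSink G V'-maximal , uniqueSource G V'-maximal
  where G = WeightedDigraph.G W
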